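{- Let $\Gamma$ be a finite group such that (i) the commutator subgroup $\Gamma'$ is abelian and some odd prime $p$ divides $|\Gamma'|$, and (ii) the abelianization $\Gamma^{ab}=\Gamma/\Gamma'$ is an elementary abelian $2$-group. Then $\Gamma$ has a quotient isomorphic to the dihedral group $D_p$ of order $2p$. -}

module Defs where

open import Level using (Level; _⊔_)
open import Algebra.Bundles using (Group)
open import Data.Nat using (ℕ; _+_; _∸_; _%_; NonZero)
open import Data.Nat.DivMod using (m%n<n)
open import Data.Fin using (Fin; toℕ; fromℕ<)
open import Data.Bool using (Bool; true; false; _xor_)
open import Data.Product using (_×_; _,_; ∃; ∃-syntax; Σ-syntax)
open import Data.List using (List; []; _∷_; foldr; length)
open import Data.List.Relation.Unary.All using (All)
open import Data.List.Relation.Unary.Any using (Any)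
open import Data.List.Relation.Unary.AllPairs using (AllPairs)
open import Relation.Nullary using (¬_)
open import Relation.Binary.PropositionalEquality using (_≡_)

module _ {c ℓ : Level} (G : Group c ℓ) where
  open Group G

  IsFinite : Set (c ⊔ ℓ)
  IsFinite = ∃[ l ] (∀ x → Any (x ≈_) l)

  comm : Carrier → Carrier → Carrier
  comm a b = ((a ⁻¹ ∙ b ⁻¹) ∙ a) ∙ b

  prodComm : List (Carrier × Carrier) → Carrier
  prodComm = foldr (λ { (a , b) acc → comm a b ∙ acc }) ε

  -- membership in the commutator subgroup Γ' (the subgroup generated by all
  -- commutators; as [a,b]⁻¹ = [b,a], it consists of finite products of commutators)
  InDerived : Carrier → Set (c ⊔ ℓ)
  InDerived x = ∃[ l ] (x ≈ prodComm l)

  DerivedAbelian : Set (c ⊔ ℓ)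
  DerivedAbelian = ∀ x y → InDerived x → InDerived y → (x ∙ y) ≈ (y ∙ x)

  DerivedHasOrder : ℕ → Set (c ⊔ ℓ)
  DerivedHasOrder k = ∃[ l ] ( AllPairs (λ x y → ¬ (x ≈ y)) l
                             × All InDerived l
                             × (∀ x → InDerived x → Any (x ≈_) l)
                             × length l ≡ k )

  AbelianizationElementary2 : Set (c ⊔ ℓ)
  AbelianizationElementary2 = ∀ g → InDerived (g ∙ g)

-- The dihedral group D_p of order 2p: element (e , a) stands for r^a s^e,
-- with (r^a s^e)(r^b s^f) = r^(a + (-1)^e b) s^(e xor f).
module _ {p : ℕ} {{_ : NonZero p}} where
  addF : Fin p → Fin p → Fin p
  addF a b = fromℕ< (m%n<n (toℕ a + toℕ b) p)

  negF : Fin p → Fin p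
  negF a = fromℕ< (m%n<n (p ∸ toℕ a) p)

  _·D_ : Bool × Fin p → Bool × Fin p → Bool × Fin p
  (e , a) ·D (f , b) = (e xor f , addF a (sgn e b))
    where
    sgn : Bool → Fin p → Fin p
    sgn false x = x
    sgn true  x = negF x

  -- Γ has a quotient isomorphic to D_p: there is a surjective homomorphism Γ → D_p
  -- (first isomorphism theorem).
  HasDihedralQuotient : ∀ {c ℓ} → Group c ℓ → Set (c ⊔ ℓ)
  HasDihedralQuotient G = Σ[ φ ∈ (Group.Carrier G → Bool × Fin p) ] ( (∀ x y → x ≈ y → φ x ≡ φ y)
                                 × (∀ x y → φ (x ∙ y) ≡ (φ x ·D φ y))
                                 × (∀ d → ∃[ g ] (φ g ≡ d)) )
    where open Group G

module Submission where

-- Γ′ is a finite abelian group of order divisible by p, so it has a character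
-- ψ : Γ′ → ℤ/p with ψ v ≠ 0 for some v: extend characters along the chain
-- {ε} ⊆ ⟨a₁⟩ ⊆ ⟨a₁, a₂⟩ ⊆ … of subgroups, starting afresh (the new generator
-- goes to 1) at a cyclic step whose index is divisible by p.  Γ acts on Γ′ by
-- conjugation; as g² ∈ Γ′ and Γ′ is abelian, the conjugations κ g are commuting
-- involutions, so (p being odd) replacing ψ by ψ ∘ (1 + κ g) or ψ ∘ (1 − κ g),
-- one g at a time, makes ψ an eigenvector of every κ g, with sign ±1.  This sign
-- is a homomorphism Γ → {±1}; it is nontrivial, since otherwise ψ would vanish on
-- all commutators.  For t of sign −1, g ↦ (sign g , ψ (g t g⁻¹ t⁻¹)) is then a
-- homomorphism onto ℤ/p ⋊ {±1} = D_p: on a ∈ Γ′ it is a ↦ (+1 , 2 ψ a).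

open import Defs hiding (comm)
open import Level using (0ℓ; _⊔_)
open import Algebra.Bundles using (Group; AbelianGroup)
open import Data.Bool using (Bool; true; false; _xor_)
import Data.Bool as Bool
open import Data.Bool.Properties using (¬-not)
open import Data.Empty using (⊥-elim)
open import Data.Fin as Fin using (Fin; toℕ; fromℕ<)
open import Data.Fin.Properties using (toℕ-fromℕ<; toℕ-injective; toℕ<n; pigeonhole; injective⇒≤)
open import Data.List using (List; []; _∷_; _++_; length; lookup; map; allFin; cartesianProductWith)
open import Data.List.Properties using (length-++; length-map; length-tabulate)
open import Data.List.Relation.Unary.All as All using (All; []; _∷_)
open import Data.List.Relation.Unary.AllPairs using ([]; _∷_)
open import Data.List.Relation.Unary.Any as Any using (Any; here; there)
import Data.List.Relation.Unary.Any.Properties as Any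
open import Data.List.Relation.Unary.Any.Properties using (lookup-index)
open import Data.List.Membership.Propositional.Properties using (∈-lookup; ∈-allFin)
import Data.List.Membership.Setoid.Properties as Membership
open import Data.List.Relation.Unary.Unique.Propositional.Properties using (allFin⁺)
import Data.List.Relation.Unary.Unique.Setoid.Properties as Unique
open import Data.Nat as ℕ using (ℕ; zero; suc; _∸_; _%_; _<_; _≤_; s≤s; s≤s⁻¹; NonZero; >-nonZero⁻¹; nonTrivial⇒n>1)
import Data.Nat.Properties as ℕ
open import Data.Nat.Coprimality using (Coprime; coprime-Bézout)
open import Data.Nat.DivMod using (_/_; m%n<n; %-distribˡ-+; m<n⇒m%n≡m; m≡m%n+[m/n]*n)
open import Data.Nat.Divisibility using (_∣_; _∣?_; n∣m⇒m%n≡0; ∣⇒≤; ∣-refl; ∣-trans; m∣m*n; n∣m*n)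
open import Data.Nat.GCD using (module Bézout)
open import Data.Nat.Primality using (Prime; prime⇒nonZero; prime⇒nonTrivial; prime⇒irreducible; euclidsLemma)
open import Data.Product using (Σ; ∃-syntax; ∃₂; _×_; _,_; proj₁; proj₂)
open import Data.Sum using (inj₁; inj₂)
open import Function using (id; _∘_)
open import Relation.Nullary using (¬_; Dec; yes; no)
import Relation.Nullary.Decidable as Dec
open import Relation.Binary using (Decidable; tri<; tri≈; tri>)
open import Relation.Binary.Bundles using (Setoid)
open import Relation.Binary.PropositionalEquality as ≡ using (_≡_; _≢_)
open import Tactic.MonoidSolver using (solve)

length-cartesianProductWith : ∀ {a b c} {A : Set a} {B : Set b} {C : Set c}
  (f : A → B → C) (xs : List A) (ys : List B) →
  length (cartesianProductWith f xs ys) ≡ length xs ℕ.* length ys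
length-cartesianProductWith f []       ys = ≡.refl
length-cartesianProductWith f (x ∷ xs) ys = ≡.trans (length-++ (map (f x) ys))
  (≡.cong₂ ℕ._+_ (length-map (f x) ys) (length-cartesianProductWith f xs ys))

module UniqueLists {c ℓ} (S : Setoid c ℓ) where
  open Setoid S
  open import Data.List.Membership.Setoid S using (_∈_)
  open import Data.List.Relation.Unary.Unique.Setoid S using (Unique)

  lookup-injective : ∀ {xs} → Unique xs → ∀ i j → lookup xs i ≈ lookup xs j → i ≡ j
  lookup-injective (_ ∷ _)      Fin.zero    Fin.zero    _ = ≡.refl
  lookup-injective (x≉xs ∷ _)   Fin.zero    (Fin.suc j) e = ⊥-elim (All.lookup x≉xs (∈-lookup j) e)
  lookup-injective (x≉xs ∷ _)   (Fin.suc i) Fin.zero    e = ⊥-elim (All.lookup x≉xs (∈-lookup i) (sym e))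
  lookup-injective (_ ∷ unique) (Fin.suc i) (Fin.suc j) e = ≡.cong Fin.suc (lookup-injective unique i j e)

  unique⇒length≤ : ∀ {xs ys} → Unique xs → (∀ x → x ∈ ys) → length xs ≤ length ys
  unique⇒length≤ {xs} {ys} unique ys-complete = injective⇒≤ λ {i} {j} e →
    lookup-injective unique i j (trans (lookup-index (ys-complete (lookup xs i)))
      (trans (reflexive (≡.cong (lookup ys) e)) (sym (lookup-index (ys-complete (lookup xs j))))))

least : ∀ {p} {P : ℕ → Set p} → (∀ n → Dec (P n)) → ∀ {n} → P n → ∃[ m ] (P m × ∀ {k} → k < m → ¬ P k)
least P? {zero} P0 = 0 , P0 , λ ()
least {P = P} P? {suc n} P[1+n] with P? 0
... | yes P0 = 0 , P0 , λ ()
... | no ¬P0 with m , P[1+m] , below ← least {P = P ∘ suc} (P? ∘ suc) P[1+n] =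
  suc m , P[1+m] , λ { {zero} _ → ¬P0 ; {suc k} k<m → below (s≤s⁻¹ k<m) }

map-proj₁-toList : ∀ {a p} {A : Set a} {P : A → Set p} {xs} (pxs : All.All P xs) →
                   map proj₁ (All.toList pxs) ≡ xs
map-proj₁-toList All.[]         = ≡.refl
map-proj₁-toList (_ All.∷ pxs) = ≡.cong (_ ∷_) (map-proj₁-toList pxs)

module Residues (p : ℕ) (p-prime : Prime p) where

  open ≡ using (refl; cong; sym; trans)
  open ≡.≡-Reasoning

  instance
    p-nonZero : NonZero p
    p-nonZero = prime⇒nonZero p-prime

  [_] : ℕ → Fin p
  [ n ] = fromℕ< (m%n<n n p)

  toℕ-[] : ∀ n → toℕ [ n ] ≡ n % p
  toℕ-[] n = toℕ-fromℕ< (m%n<n n p)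

  []-cong : ∀ {m n} → m % p ≡ n % p → [ m ] ≡ [ n ]
  []-cong {m} {n} eq = toℕ-injective (trans (toℕ-[] m) (trans eq (sym (toℕ-[] n))))

  [toℕ] : ∀ x → [ toℕ x ] ≡ x
  [toℕ] x = toℕ-injective (trans (toℕ-[] (toℕ x)) (m<n⇒m%n≡m (toℕ<n x)))

  []-+ : ∀ m n → addF [ m ] [ n ] ≡ [ m ℕ.+ n ]
  []-+ m n = []-cong (trans (≡.cong₂ (λ i j → (i ℕ.+ j) % p) (toℕ-[] m) (toℕ-[] n))
                           (sym (%-distribˡ-+ m n p)))

  p∣n⇒[n]≡[0] : ∀ {n} → p ∣ n → [ n ] ≡ [ 0 ]
  p∣n⇒[n]≡[0] {n} p∣n = []-cong (trans (n∣m⇒m%n≡0 n p p∣n) (sym (m<n⇒m%n≡m (>-nonZero⁻¹ p))))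

  ℤₚ : AbelianGroup 0ℓ 0ℓ
  ℤₚ = record
    { Carrier = Fin p ; _≈_ = _≡_ ; _∙_ = addF ; ε = [ 0 ] ; _⁻¹ = negF
    ; isAbelianGroup = record
      { isGroup = record
        { isMonoid = record
          { isSemigroup = record
            { isMagma = record { isEquivalence = ≡.isEquivalence ; ∙-cong = ≡.cong₂ addF }
            ; assoc = addF-assoc }
          ; identity = addF-identityˡ , λ x → trans (addF-comm x [ 0 ]) (addF-identityˡ x) }
        ; inverse = (λ x → trans (addF-comm (negF x) x) (addF-inverseʳ x)) , addF-inverseʳ
        ; ⁻¹-cong = cong negF }
      ; comm = addF-comm } }
    where
    addF-assoc : ∀ x y z → addF (addF x y) z ≡ addF x (addF y z)
    addF-assoc x y z = begin
      addF (addF x y) z                          ≡⟨ cong (addF (addF x y)) ([toℕ] z) ⟨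
      addF [ toℕ x ℕ.+ toℕ y ] [ toℕ z ]         ≡⟨ []-+ (toℕ x ℕ.+ toℕ y) (toℕ z) ⟩
      [ toℕ x ℕ.+ toℕ y ℕ.+ toℕ z ]              ≡⟨ cong [_] (ℕ.+-assoc (toℕ x) (toℕ y) (toℕ z)) ⟩
      [ toℕ x ℕ.+ (toℕ y ℕ.+ toℕ z) ]            ≡⟨ []-+ (toℕ x) (toℕ y ℕ.+ toℕ z) ⟨
      addF [ toℕ x ] (addF y z)                  ≡⟨ cong (λ x′ → addF x′ (addF y z)) ([toℕ] x) ⟩
      addF x (addF y z)                          ∎

    addF-comm : ∀ x y → addF x y ≡ addF y x
    addF-comm x y = cong [_] (ℕ.+-comm (toℕ x) (toℕ y))

    addF-identityˡ : ∀ x → addF [ 0 ] x ≡ x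
    addF-identityˡ x = trans (cong (addF [ 0 ]) (sym ([toℕ] x))) (trans ([]-+ 0 (toℕ x)) ([toℕ] x))

    addF-inverseʳ : ∀ x → addF x (negF x) ≡ [ 0 ]
    addF-inverseʳ x = begin
      addF x (negF x)                    ≡⟨ cong (λ x′ → addF x′ (negF x)) ([toℕ] x) ⟨
      addF [ toℕ x ] [ p ∸ toℕ x ]       ≡⟨ []-+ (toℕ x) (p ∸ toℕ x) ⟩
      [ toℕ x ℕ.+ (p ∸ toℕ x) ]          ≡⟨ cong [_] (ℕ.m+[n∸m]≡n (ℕ.<⇒≤ (toℕ<n x))) ⟩
      [ p ]                              ≡⟨ p∣n⇒[n]≡[0] ∣-refl ⟩
      [ 0 ]                              ∎

  open AbelianGroup ℤₚ public
    using () renaming (_∙_ to _+_; ε to 0#; _⁻¹ to -_; assoc to +-assoc; comm to +-comm;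
                       identityˡ to +-identityˡ; identityʳ to +-identityʳ; inverseʳ to +-inverseʳ)
  open import Algebra.Properties.AbelianGroup ℤₚ public
    using () renaming (⁻¹-involutive to -‿involutive; inverseʳ-unique to +-inverseʳ-unique;
                       identityˡ-unique to +-identityˡ-unique)
  open import Algebra.Properties.CommutativeSemigroup (AbelianGroup.commutativeSemigroup ℤₚ) public
    using () renaming (interchange to +-interchange)
  open import Algebra.Properties.Monoid.Mult (AbelianGroup.monoid ℤₚ) public
    using () renaming (_×_ to _·_; ×-homo-1 to ·-homo-1; ×-homo-+ to ·-homo-+;
                       ×-assocˡ to ·-assocˡ; ×-congˡ to ·-congˡ)

  1# : Fin p
  1# = [ 1 ]

  ·-[] : ∀ n x → n · x ≡ [ n ℕ.* toℕ x ]
  ·-[] ℕ.zero    x = refl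
  ·-[] (suc n) x = begin
    x + n · x                      ≡⟨ ≡.cong₂ _+_ (sym ([toℕ] x)) (·-[] n x) ⟩
    [ toℕ x ] + [ n ℕ.* toℕ x ]    ≡⟨ []-+ (toℕ x) (n ℕ.* toℕ x) ⟩
    [ toℕ x ℕ.+ n ℕ.* toℕ x ]      ∎

  ·-divMod : ∀ n m .{{_ : NonZero m}} x → n · x ≡ (n % m) · x + (n / m) · (m · x)
  ·-divMod n m x = begin
    n · x                                 ≡⟨ ·-congˡ (m≡m%n+[m/n]*n n m) ⟩
    (n % m ℕ.+ n / m ℕ.* m) · x           ≡⟨ ·-homo-+ x (n % m) (n / m ℕ.* m) ⟩
    (n % m) · x + (n / m ℕ.* m) · x       ≡⟨ ≡.cong ((n % m) · x +_) (·-assocˡ x (n / m) m) ⟨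
    (n % m) · x + (n / m) · (m · x)       ∎

  ·-zeroʳ : ∀ n → n · 0# ≡ 0#
  ·-zeroʳ ℕ.zero    = refl
  ·-zeroʳ (suc n) = trans (+-identityˡ (n · 0#)) (·-zeroʳ n)

  p∣n⇒n·x≡0# : ∀ {n} x → p ∣ n → n · x ≡ 0#
  p∣n⇒n·x≡0# {n} x p∣n = trans (·-[] n x) (p∣n⇒[n]≡[0] (∣-trans p∣n (m∣m*n (toℕ x))))

  ∤⇒coprime : ∀ {m} → ¬ p ∣ m → Coprime m p
  ∤⇒coprime p∤m (d∣m , d∣p) with prime⇒irreducible p-prime d∣p
  ... | inj₁ d≡1 = d≡1
  ... | inj₂ refl = ⊥-elim (p∤m d∣m)

  [p∸1]·x≡-x : ∀ x → (p ∸ 1) · x ≡ - x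
  [p∸1]·x≡-x x = +-inverseʳ-unique x ((p ∸ 1) · x) (begin
    x + (p ∸ 1) · x             ≡⟨ ≡.cong (_+ (p ∸ 1) · x) (·-homo-1 x) ⟨
    1 · x + (p ∸ 1) · x         ≡⟨ ·-homo-+ x 1 (p ∸ 1) ⟨
    (1 ℕ.+ (p ∸ 1)) · x         ≡⟨ p∣n⇒n·x≡0# x (≡.subst (p ∣_) (sym (ℕ.m+[n∸m]≡n (>-nonZero⁻¹ p))) ∣-refl) ⟩
    0#                          ∎)

  ·-invertible : ∀ {m} → ¬ p ∣ m → ∃[ u ] ∀ x → u · (m · x) ≡ x
  ·-invertible {m} p∤m with coprime-Bézout (∤⇒coprime p∤m)
  ... | Bézout.+- u k 1+kp≡um = u , λ x → begin
    u · (m · x)                 ≡⟨ ·-assocˡ x u m ⟩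
    (u ℕ.* m) · x               ≡⟨ ·-congˡ 1+kp≡um ⟨
    (1 ℕ.+ k ℕ.* p) · x         ≡⟨ ·-homo-+ x 1 (k ℕ.* p) ⟩
    1 · x + (k ℕ.* p) · x       ≡⟨ ≡.cong₂ _+_ (·-homo-1 x) (p∣n⇒n·x≡0# x (n∣m*n k)) ⟩
    x + 0#                      ≡⟨ +-identityʳ x ⟩
    x                           ∎
  -- Here u · m acts as -1, so (p - 1) · u inverts m.
  ... | Bézout.-+ u k 1+um≡kp = (p ∸ 1) ℕ.* u , λ x → begin
    ((p ∸ 1) ℕ.* u) · (m · x)   ≡⟨ ·-assocˡ (m · x) (p ∸ 1) u ⟨
    (p ∸ 1) · (u · (m · x))     ≡⟨ ≡.cong ((p ∸ 1) ·_) (u·m·x≡-x x) ⟩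
    (p ∸ 1) · - x               ≡⟨ [p∸1]·x≡-x (- x) ⟩
    - - x                       ≡⟨ -‿involutive x ⟩
    x                           ∎
    where
    u·m·x≡-x : ∀ x → u · (m · x) ≡ - x
    u·m·x≡-x x = +-inverseʳ-unique x (u · (m · x)) (begin
      x + u · (m · x)           ≡⟨ ≡.cong₂ _+_ (·-homo-1 x) (sym (·-assocˡ x u m)) ⟨
      1 · x + (u ℕ.* m) · x     ≡⟨ ·-homo-+ x 1 (u ℕ.* m) ⟨
      (1 ℕ.+ u ℕ.* m) · x       ≡⟨ p∣n⇒n·x≡0# x (≡.subst (p ∣_) (sym 1+um≡kp) (n∣m*n k)) ⟩
      0#                        ∎)

  ·-injective : ∀ {m x} → ¬ p ∣ m → m · x ≡ 0# → x ≡ 0#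
  ·-injective {m} {x} p∤m m·x≡0 with u , u·m· ← ·-invertible p∤m = begin
    x             ≡⟨ u·m· x ⟨
    u · (m · x)   ≡⟨ ≡.cong (u ·_) m·x≡0 ⟩
    u · 0#        ≡⟨ ·-zeroʳ u ⟩
    0#            ∎

  ·-surjective : ∀ {m} → ¬ p ∣ m → ∀ y → ∃[ x ] m · x ≡ y
  ·-surjective {m} p∤m y with u , u·m· ← ·-invertible p∤m = u · y , (begin
    m · (u · y)          ≡⟨ ·-assocˡ y m u ⟩
    (m ℕ.* u) · y        ≡⟨ ·-congˡ (ℕ.*-comm m u) ⟩
    (u ℕ.* m) · y        ≡⟨ ·-assocˡ y u m ⟨
    u · (m · y)          ≡⟨ u·m· y ⟩
    y                    ∎)

  ≢0#⇒∤ : ∀ {c} → c ≢ 0# → ¬ p ∣ toℕ c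
  ≢0#⇒∤ {c} c≢0 p∣c = c≢0 (trans (sym ([toℕ] c)) (p∣n⇒[n]≡[0] p∣c))

  ·-generates : ∀ {c} → c ≢ 0# → ∀ w → ∃[ n ] n · c ≡ w
  ·-generates {c} c≢0 w with d , c·d≡w ← ·-surjective (≢0#⇒∤ c≢0) w = toℕ d , (begin
    toℕ d · c                ≡⟨ ·-[] (toℕ d) c ⟩
    [ toℕ d ℕ.* toℕ c ]      ≡⟨ ≡.cong [_] (ℕ.*-comm (toℕ d) (toℕ c)) ⟩
    [ toℕ c ℕ.* toℕ d ]      ≡⟨ ·-[] (toℕ c) d ⟨
    toℕ c · d                ≡⟨ c·d≡w ⟩
    w                        ∎)

  1<p : 1 < p
  1<p = nonTrivial⇒n>1 p {{prime⇒nonTrivial p-prime}}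

  1#≢0# : 1# ≢ 0#
  1#≢0# 1≡0 = ℕ.1+n≢0 (begin
    1          ≡⟨ m<n⇒m%n≡m 1<p ⟨
    1 % p      ≡⟨ toℕ-[] 1 ⟨
    toℕ 1#     ≡⟨ cong toℕ 1≡0 ⟩
    toℕ 0#     ≡⟨ toℕ-[] 0 ⟩
    0 % p      ≡⟨ m<n⇒m%n≡m (>-nonZero⁻¹ p) ⟩
    0          ∎)

  sgn : Bool → Fin p → Fin p
  sgn false x = x
  sgn true  x = - x

  sgn-xor : ∀ e f x → sgn e (sgn f x) ≡ sgn (e xor f) x
  sgn-xor false f     x = refl
  sgn-xor true  false x = refl
  sgn-xor true  true  x = -‿involutive x

  module _ (p-odd : ¬ 2 ∣ p) where

    p∤2 : ¬ p ∣ 2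
    p∤2 p∣2 = p-odd (≡.subst (2 ∣_) (ℕ.≤-antisym 1<p (∣⇒≤ p∣2)) ∣-refl)

    x+x≡2·x : ∀ x → x + x ≡ 2 · x
    x+x≡2·x x = ≡.cong (x +_) (sym (+-identityʳ x))

    x+x≡0#⇒x≡0# : ∀ {x} → x + x ≡ 0# → x ≡ 0#
    x+x≡0#⇒x≡0# {x} x+x≡0 = ·-injective p∤2 (trans (sym (x+x≡2·x x)) x+x≡0)

    halve : ∀ w → ∃[ x ] x + x ≡ w
    halve w with x , 2·x≡w ← ·-surjective p∤2 w = x , trans (x+x≡2·x x) 2·x≡w

    x≡-x⇒x≡0# : ∀ {x} → x ≡ - x → x ≡ 0#
    x≡-x⇒x≡0# {x} x≡-x = x+x≡0#⇒x≡0# (trans (≡.cong (x +_) x≡-x) (+-inverseʳ x))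

    sgn-injective : ∀ {c} → c ≢ 0# → ∀ e f → sgn e c ≡ sgn f c → e ≡ f
    sgn-injective c≢0 false false _    = refl
    sgn-injective c≢0 false true  c≡-c = ⊥-elim (c≢0 (x≡-x⇒x≡0# c≡-c))
    sgn-injective c≢0 true  false -c≡c = ⊥-elim (c≢0 (x≡-x⇒x≡0# (sym -c≡c)))
    sgn-injective c≢0 true  true  _    = refl

module Characters {a ℓ} (A : AbelianGroup a ℓ) (p : ℕ) (p-prime : Prime p) where
  open AbelianGroup A
  open import Algebra.Properties.Monoid.Mult monoid as Mult using ()
  open Residues p p-prime

  -- x ^ n unfolds to n × x, so the stdlib lemmas on multiples (×-homo-+, …) apply.
  infixr 8 _^_
  _^_ : Carrier → ℕ → Carrier
  x ^ n = n Mult.× x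

  record IsCharacter (ψ : Carrier → Fin p) : Set (a ⊔ ℓ) where
    field
      cong : ∀ {x y} → x ≈ y → ψ x ≡ ψ y
      homo : ∀ x y → ψ (x ∙ y) ≡ ψ x + ψ y

    ε-homo : ψ ε ≡ 0#
    ε-homo = +-identityˡ-unique (ψ ε) (ψ ε) (≡.trans (≡.sym (homo ε ε)) (cong (identityˡ ε)))

    ⁻¹-homo : ∀ x → ψ (x ⁻¹) ≡ - ψ x
    ⁻¹-homo x = +-inverseʳ-unique (ψ x) (ψ (x ⁻¹))
      (≡.trans (≡.sym (homo x (x ⁻¹))) (≡.trans (cong (inverseʳ x)) ε-homo))

    ^-homo : ∀ x n → ψ (x ^ n) ≡ n · ψ x
    ^-homo x zero    = ε-homo
    ^-homo x (suc n) = ≡.trans (homo x (x ^ n)) (≡.cong (ψ x +_) (^-homo x n))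

    ∘-isCharacter : ∀ {τ} → (∀ {x y} → x ≈ y → τ x ≈ τ y) → (∀ x y → τ (x ∙ y) ≈ τ x ∙ τ y) →
                    IsCharacter (ψ ∘ τ)
    ∘-isCharacter {τ} τ-cong τ-homo = record
      { cong = cong ∘ τ-cong ; homo = λ x y → ≡.trans (cong (τ-homo x y)) (homo (τ x) (τ y)) }

    surjective : ∀ {v} → ψ v ≢ 0# → ∀ w → ∃[ x ] ψ x ≡ w
    surjective {v} ψv≢0 w with n , n·ψv≡w ← ·-generates ψv≢0 w = v ^ n , ≡.trans (^-homo v n) n·ψv≡w

module FiniteAbelianGroup {a ℓ} (A : AbelianGroup a ℓ) (p : ℕ) (p-prime : Prime p) where
  open AbelianGroup A
  open import Algebra.Properties.AbelianGroup A using (identityˡ-unique; inverseʳ-unique; ∙-cancelˡ)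
  open import Algebra.Properties.CommutativeSemigroup commutativeSemigroup using (interchange; xy∙z≈y∙xz)
  open import Algebra.Properties.Monoid monoid using (cancelʳ)
  open import Algebra.Properties.Monoid.Mult monoid using (×-homo-1; ×-homo-+; ×-assocˡ; ×-congˡ)
  open import Data.List.Membership.Setoid setoid using (_∈_; _∉_)
  open import Data.List.Relation.Binary.Subset.Setoid setoid using (_⊆_)
  open import Data.List.Relation.Unary.Unique.Setoid setoid using (Unique)
  import Relation.Binary.Reasoning.Setoid setoid as ≈-Reasoning
  open UniqueLists setoid
  open Residues p p-prime
  open Characters A p p-prime

  module _ (enumeration : List Carrier) (complete : ∀ x → x ∈ enumeration)
           (distinct : Unique enumeration) where

    infix 4 _≟_ _∈?_
    _≟_ : Decidable _≈_
    x ≟ y = Dec.map′ (Membership.index-injective setoid (complete x) (complete y))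
      (λ x≈y → lookup-injective distinct _ _
        (trans (sym (lookup-index (complete x))) (trans x≈y (lookup-index (complete y)))))
      (Any.index (complete x) Fin.≟ Any.index (complete y))

    _∈?_ : ∀ x xs → Dec (x ∈ xs)
    x ∈? xs = Any.any? (x ≟_) xs

    has-finite-order : ∀ x → ∃[ k ] x ^ suc k ≈ ε
    has-finite-order x
      with i , j , i<j , same-index ← pigeonhole (ℕ.n<1+n (length enumeration))
                                                  (λ i → Any.index (complete (x ^ toℕ i)))
      = k , identityˡ-unique (x ^ suc k) (x ^ toℕ i) (begin
        x ^ suc k ∙ x ^ toℕ i     ≈⟨ ×-homo-+ x (suc k) (toℕ i) ⟨
        x ^ (suc k ℕ.+ toℕ i)     ≈⟨ ×-congˡ (≡.trans (≡.sym (ℕ.+-suc k (toℕ i))) (ℕ.m∸n+n≡m i<j)) ⟩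
        x ^ toℕ j                 ≈⟨ Membership.index-injective setoid (complete _) (complete _) same-index ⟨
        x ^ toℕ i                 ∎)
      where
      open ≈-Reasoning
      k = toℕ j ∸ suc (toℕ i)

    record FiniteSubgroup : Set (a ⊔ ℓ) where
      field
        elements : List Carrier
        unique   : Unique elements
        ε∈       : ε ∈ elements
        ∙-closed : ∀ {x y} → x ∈ elements → y ∈ elements → x ∙ y ∈ elements

      ^-closed : ∀ {x} n → x ∈ elements → x ^ n ∈ elements
      ^-closed zero    _  = ε∈
      ^-closed (suc n) x∈ = ∙-closed x∈ (^-closed n x∈)

      ⁻¹-closed : ∀ {x} → x ∈ elements → x ⁻¹ ∈ elements
      ⁻¹-closed {x} x∈ with k , x^[1+k]≈ε ← has-finite-order x =
        Membership.∈-resp-≈ setoid (inverseʳ-unique x (x ^ k) x^[1+k]≈ε) (^-closed k x∈)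

    open FiniteSubgroup using (elements)

    record IsCharacterOn (H : FiniteSubgroup) (χ : Carrier → Fin p) : Set (a ⊔ ℓ) where
      open FiniteSubgroup H hiding (elements)
      field
        cong : ∀ {x y} → x ∈ elements H → x ≈ y → χ x ≡ χ y
        homo : ∀ {x y} → x ∈ elements H → y ∈ elements H → χ (x ∙ y) ≡ χ x + χ y

      ε-homo : χ ε ≡ 0#
      ε-homo = +-identityˡ-unique (χ ε) (χ ε) (≡.trans (≡.sym (homo ε∈ ε∈)) (cong (∙-closed ε∈ ε∈) (identityˡ ε)))

      ^-homo : ∀ {x} n → x ∈ elements H → χ (x ^ n) ≡ n · χ x
      ^-homo zero    _  = ε-homo
      ^-homo {x} (suc n) x∈ = ≡.trans (homo x∈ (^-closed n x∈)) (≡.cong (χ x +_) (^-homo n x∈))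

    record NonzeroCharacterOn (H : FiniteSubgroup) : Set (a ⊔ ℓ) where
      field
        χ             : Carrier → Fin p
        isCharacterOn : IsCharacterOn H χ
        v             : Carrier
        v∈H           : v ∈ elements H
        χv≢0          : χ v ≢ 0#

    module CyclicExtension (H : FiniteSubgroup) (a : Carrier) where
      open FiniteSubgroup H hiding (elements)
      open ≈-Reasoning

      -- opaque, so that order never unfolds into the pigeonhole search
      opaque
       least-exponent : ∃[ m ] (a ^ suc m ∈ elements H × ∀ {k} → k < m → a ^ suc k ∉ elements H)
       least-exponent with k , a^[1+k]≈ε ← has-finite-order a =
         least (λ k → a ^ suc k ∈? elements H) {k} (Membership.∈-resp-≈ setoid (sym a^[1+k]≈ε) ε∈)

      -- the order of a modulo H, i.e. the index of H in H⟨a⟩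
      order : ℕ
      order = suc (proj₁ least-exponent)

      a^order∈H : a ^ order ∈ elements H
      a^order∈H = proj₁ (proj₂ least-exponent)

      a^k∉H : ∀ {k} → 0 < k → k < order → a ^ k ∉ elements H
      a^k∉H {suc k} _ (s≤s k<m) = proj₂ (proj₂ least-exponent) k<m

      a^i∙b≉a^j∙b′ : ∀ {i j b b′} → i < j → j < order → b ∈ elements H → b′ ∈ elements H →
                     ¬ a ^ i ∙ b ≈ a ^ j ∙ b′
      a^i∙b≉a^j∙b′ {i} {j} {b} {b′} i<j j<order b∈ b′∈ eq =
        a^k∉H (ℕ.m<n⇒0<n∸m i<j) (ℕ.≤-<-trans (ℕ.m∸n≤m j i) j<order)
          (Membership.∈-resp-≈ setoid a^[j∸i]≈b/b′ (∙-closed b∈ (⁻¹-closed b′∈)))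
        where
        b≈a^[j∸i]∙b′ : b ≈ a ^ (j ∸ i) ∙ b′
        b≈a^[j∸i]∙b′ = ∙-cancelˡ (a ^ i) _ _ (begin
          a ^ i ∙ b                     ≈⟨ eq ⟩
          a ^ j ∙ b′                    ≈⟨ ∙-congʳ (×-congˡ (ℕ.m∸n+n≡m (ℕ.<⇒≤ i<j))) ⟨
          a ^ (j ∸ i ℕ.+ i) ∙ b′        ≈⟨ ∙-congʳ (×-homo-+ a (j ∸ i) i) ⟩
          a ^ (j ∸ i) ∙ a ^ i ∙ b′      ≈⟨ xy∙z≈y∙xz (a ^ (j ∸ i)) (a ^ i) b′ ⟩
          a ^ i ∙ (a ^ (j ∸ i) ∙ b′)    ∎)
        a^[j∸i]≈b/b′ : b ∙ b′ ⁻¹ ≈ a ^ (j ∸ i)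
        a^[j∸i]≈b/b′ = trans (∙-congʳ b≈a^[j∸i]∙b′) (cancelʳ (inverseʳ b′) (a ^ (j ∸ i)))

      decomposition-unique : ∀ {i j b b′} → i < order → j < order → b ∈ elements H → b′ ∈ elements H →
                             a ^ i ∙ b ≈ a ^ j ∙ b′ → i ≡ j × b ≈ b′
      decomposition-unique {i} {j} i<order j<order b∈ b′∈ eq with ℕ.<-cmp i j
      ... | tri< i<j _ _ = ⊥-elim (a^i∙b≉a^j∙b′ i<j j<order b∈ b′∈ eq)
      ... | tri> _ _ j<i = ⊥-elim (a^i∙b≉a^j∙b′ j<i i<order b′∈ b∈ (sym eq))
      ... | tri≈ _ ≡.refl _ = ≡.refl , ∙-cancelˡ (a ^ i) _ _ eq

      h : Fin (length (elements H)) → Carrier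
      h = lookup (elements H)

      h∈H : ∀ k → h k ∈ elements H
      h∈H = Membership.∈-lookup setoid (elements H)

      generator : Fin order → Fin (length (elements H)) → Carrier
      generator i k = a ^ toℕ i ∙ h k

      extension : List Carrier
      extension = cartesianProductWith generator (allFin order) (allFin (length (elements H)))

      ∈-extension⁻ : ∀ {x} → x ∈ extension → ∃₂ λ i k → x ≈ generator i k
      ∈-extension⁻ x∈ with i , k , _ , _ , x≈ ← Membership.∈-cartesianProductWith⁻
                             (≡.setoid _) (≡.setoid _) setoid generator (allFin order) (allFin (length (elements H))) x∈
                             = i , k , x≈

      reduce-exponent : ∀ n b → a ^ n ∙ b ≈ a ^ (n % order) ∙ ((a ^ order) ^ (n / order) ∙ b)
      reduce-exponent n b = begin
        a ^ n ∙ b                                             ≈⟨ ∙-congʳ (×-congˡ (m≡m%n+[m/n]*n n order)) ⟩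
        a ^ (n % order ℕ.+ n / order ℕ.* order) ∙ b          ≈⟨ ∙-congʳ (×-homo-+ a (n % order) _) ⟩
        a ^ (n % order) ∙ a ^ (n / order ℕ.* order) ∙ b      ≈⟨ ∙-congʳ (∙-congˡ (×-assocˡ a (n / order) order)) ⟨
        a ^ (n % order) ∙ (a ^ order) ^ (n / order) ∙ b      ≈⟨ assoc _ _ _ ⟩
        a ^ (n % order) ∙ ((a ^ order) ^ (n / order) ∙ b)    ∎

      ∈-extension⁺ : ∀ n {b} → b ∈ elements H → a ^ n ∙ b ∈ extension
      ∈-extension⁺ n {b} b∈ = Membership.∈-resp-≈ setoid generator-i-k≈a^n∙b
        (Membership.∈-cartesianProductWith⁺ (≡.setoid _) (≡.setoid _) setoid
          (λ { ≡.refl ≡.refl → refl }) (∈-allFin i) (∈-allFin k))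
        where
        i = fromℕ< (m%n<n n order)
        b₀∈ = ∙-closed (^-closed (n / order) a^order∈H) b∈
        k = Any.index b₀∈
        generator-i-k≈a^n∙b : generator i k ≈ a ^ n ∙ b
        generator-i-k≈a^n∙b = begin
          a ^ toℕ i ∙ h k
            ≈⟨ ∙-cong (×-congˡ (toℕ-fromℕ< (m%n<n n order))) (sym (lookup-index b₀∈)) ⟩
          a ^ (n % order) ∙ ((a ^ order) ^ (n / order) ∙ b)
            ≈⟨ reduce-exponent n b ⟨
          a ^ n ∙ b
            ∎

      generator-∙ : ∀ i j k l → generator i k ∙ generator j l ≈ a ^ (toℕ i ℕ.+ toℕ j) ∙ (h k ∙ h l)
      generator-∙ i j k l = trans (interchange _ _ _ _) (∙-congʳ (sym (×-homo-+ a (toℕ i) (toℕ j))))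

      extended : FiniteSubgroup
      extended = record
        { elements = extension
        ; unique   = Unique.cartesianProductWith⁺ (≡.setoid _) (≡.setoid _) setoid generator
                       generator-injective (allFin⁺ order) (allFin⁺ (length (elements H)))
        ; ε∈       = Membership.∈-resp-≈ setoid (identityˡ ε) (∈-extension⁺ 0 ε∈)
        ; ∙-closed = ∙-closed′ }
        where
        generator-injective : ∀ {i j k l} → generator i k ≈ generator j l → i ≡ j × k ≡ l
        generator-injective {i} {j} {k} {l} eq
          with i≡j , hk≈hl ← decomposition-unique (toℕ<n i) (toℕ<n j) (h∈H k) (h∈H l) eq
          = toℕ-injective i≡j , lookup-injective unique k l hk≈hl
        ∙-closed′ : ∀ {x y} → x ∈ extension → y ∈ extension → x ∙ y ∈ extension
        ∙-closed′ x∈ y∈ with i , k , x≈ ← ∈-extension⁻ x∈ | j , l , y≈ ← ∈-extension⁻ y∈ =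
          Membership.∈-resp-≈ setoid (sym (trans (∙-cong x≈ y≈) (generator-∙ i j k l)))
            (∈-extension⁺ (toℕ i ℕ.+ toℕ j) (∙-closed (h∈H k) (h∈H l)))

      length-extension : length extension ≡ order ℕ.* length (elements H)
      length-extension = ≡.trans (length-cartesianProductWith generator (allFin order) (allFin (length (elements H))))
        (≡.cong₂ ℕ._*_ (length-tabulate {n = order} id) (length-tabulate {n = length (elements H)} id))

      H⊆extension : ∀ {b} → b ∈ elements H → b ∈ extension
      H⊆extension {b} b∈ = Membership.∈-resp-≈ setoid (identityˡ b) (∈-extension⁺ 0 b∈)

      a∈extension : a ∈ extension
      a∈extension = Membership.∈-resp-≈ setoid (trans (∙-congʳ (×-homo-1 a)) (identityʳ a)) (∈-extension⁺ 1 ε∈)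

    module CharacterExtension (H : FiniteSubgroup) (a : Carrier) {χ} (χ-isCharacterOn : IsCharacterOn H χ)
      (c : Fin p) (compatible : CyclicExtension.order H a · c ≡ χ (a ^ CyclicExtension.order H a)) where
      open FiniteSubgroup H hiding (elements)
      open CyclicExtension H a
      open IsCharacterOn χ-isCharacterOn
      open ≡.≡-Reasoning

      -- extend (a ^ i ∙ h k) = i · c + χ (h k), reading i and k off the decomposition found
      -- by searching the list; decomposition-unique and compatible make this well defined.
      value : ∀ {x} → ∃₂ (λ i k → x ≈ generator i k) → Fin p
      value (i , k , _) = toℕ i · c + χ (h k)

      extend : Carrier → Fin p
      extend x with x ∈? extension
      ... | yes x∈ = value (∈-extension⁻ x∈)
      ... | no  _  = 0#

      χ-b₀ : ∀ n {b} → b ∈ elements H → χ ((a ^ order) ^ (n / order) ∙ b) ≡ (n / order) · (order · c) + χ b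
      χ-b₀ n {b} b∈ = begin
        χ ((a ^ order) ^ (n / order) ∙ b)         ≡⟨ homo (^-closed (n / order) a^order∈H) b∈ ⟩
        χ ((a ^ order) ^ (n / order)) + χ b       ≡⟨ ≡.cong (_+ χ b) (^-homo (n / order) a^order∈H) ⟩
        (n / order) · χ (a ^ order) + χ b         ≡⟨ ≡.cong (λ y → (n / order) · y + χ b) compatible ⟨
        (n / order) · (order · c) + χ b           ∎

      value-spec : ∀ n {b x} → b ∈ elements H → x ≈ a ^ n ∙ b →
                   (d : ∃₂ λ i k → x ≈ generator i k) → value d ≡ n · c + χ b
      value-spec n {b} b∈ x≈a^n∙b (i , k , x≈)
        with i≡n%order , hk≈b₀ ← decomposition-unique (toℕ<n i) (m%n<n n order) (h∈H k)
                                   (∙-closed (^-closed (n / order) a^order∈H) b∈)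
                                   (trans (sym x≈) (trans x≈a^n∙b (reduce-exponent n b))) = begin
        toℕ i · c + χ (h k)
          ≡⟨ ≡.cong₂ (λ j y → j · c + y) i≡n%order (cong (h∈H k) hk≈b₀) ⟩
        (n % order) · c + χ ((a ^ order) ^ (n / order) ∙ b)
          ≡⟨ ≡.cong ((n % order) · c +_) (χ-b₀ n b∈) ⟩
        (n % order) · c + ((n / order) · (order · c) + χ b)
          ≡⟨ +-assoc _ _ _ ⟨
        (n % order) · c + (n / order) · (order · c) + χ b
          ≡⟨ ≡.cong (_+ χ b) (·-divMod n order c) ⟨
        n · c + χ b
          ∎

      extend-spec : ∀ n {b x} → b ∈ elements H → x ≈ a ^ n ∙ b → extend x ≡ n · c + χ b
      extend-spec n {b} {x} b∈ x≈a^n∙b with x ∈? extension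
      ... | yes x∈ = value-spec n b∈ x≈a^n∙b (∈-extension⁻ x∈)
      ... | no  x∉ = ⊥-elim (x∉ (Membership.∈-resp-≈ setoid (sym x≈a^n∙b) (∈-extension⁺ n b∈)))

      extend-isCharacterOn : IsCharacterOn extended extend
      extend-isCharacterOn = record { cong = cong′ ; homo = homo′ }
        where
        cong′ : ∀ {x y} → x ∈ extension → x ≈ y → extend x ≡ extend y
        cong′ x∈ x≈y with i , k , x≈ ← ∈-extension⁻ x∈ =
          ≡.trans (extend-spec (toℕ i) (h∈H k) x≈) (≡.sym (extend-spec (toℕ i) (h∈H k) (trans (sym x≈y) x≈)))
        homo′ : ∀ {x y} → x ∈ extension → y ∈ extension → extend (x ∙ y) ≡ extend x + extend y
        homo′ {x} {y} x∈ y∈ with i , k , x≈ ← ∈-extension⁻ x∈ | j , l , y≈ ← ∈-extension⁻ y∈ = begin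
          extend (x ∙ y)
            ≡⟨ extend-spec (toℕ i ℕ.+ toℕ j) (∙-closed (h∈H k) (h∈H l)) (trans (∙-cong x≈ y≈) (generator-∙ i j k l)) ⟩
          (toℕ i ℕ.+ toℕ j) · c + χ (h k ∙ h l)
            ≡⟨ ≡.cong₂ _+_ (·-homo-+ c (toℕ i) (toℕ j)) (homo (h∈H k) (h∈H l)) ⟩
          (toℕ i · c + toℕ j · c) + (χ (h k) + χ (h l))
            ≡⟨ +-interchange (toℕ i · c) (toℕ j · c) (χ (h k)) (χ (h l)) ⟩
          (toℕ i · c + χ (h k)) + (toℕ j · c + χ (h l))
            ≡⟨ ≡.cong₂ _+_ (extend-spec (toℕ i) (h∈H k) x≈) (extend-spec (toℕ j) (h∈H l) y≈) ⟨
          extend x + extend y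
            ∎

      extend-extends : ∀ {b} → b ∈ elements H → extend b ≡ χ b
      extend-extends {b} b∈ = ≡.trans (extend-spec 0 b∈ (sym (identityˡ b))) (+-identityˡ (χ b))

      extend-a≡c : extend a ≡ c
      extend-a≡c = begin
        extend a       ≡⟨ extend-spec 1 ε∈ (sym (trans (∙-congʳ (×-homo-1 a)) (identityʳ a))) ⟩
        1 · c + χ ε    ≡⟨ ≡.cong₂ _+_ (·-homo-1 c) ε-homo ⟩
        c + 0#         ≡⟨ +-identityʳ c ⟩
        c              ∎

    trivial : FiniteSubgroup
    trivial = record
      { elements = ε ∷ []
      ; unique   = [] ∷ []
      ; ε∈       = here refl
      ; ∙-closed = λ { (here x≈ε) (here y≈ε) → here (trans (∙-cong x≈ε y≈ε) (identityˡ ε)) } }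

    record Stage (xs : List Carrier) : Set (a ⊔ ℓ) where
      field
        subgroup  : FiniteSubgroup
        contains  : xs ⊆ elements subgroup
        character : p ∣ length (elements subgroup) → NonzeroCharacterOn subgroup

    -- |H⟨a⟩| = order · |H|.  If p ∣ order, extend the zero character by a ↦ 1; otherwise
    -- p ∣ |H|, and the old character extends since order is invertible modulo p.
    stage : ∀ xs → Stage xs
    stage [] = record
      { subgroup  = trivial
      ; contains  = λ ()
      ; character = λ p∣1 → ⊥-elim (ℕ.<⇒≱ 1<p (∣⇒≤ p∣1)) }
    stage (a ∷ xs) = record
      { subgroup  = extended
      ; contains  = λ { (here x≈a) → Membership.∈-resp-≈ setoid (sym x≈a) a∈extension
                      ; (there x∈xs) → H⊆extension (contains x∈xs) }
      ; character = character′ }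
      where
      open Stage (stage xs)
      open CyclicExtension subgroup a
      character′ : p ∣ length extension → NonzeroCharacterOn extended
      character′ p∣|E| with p ∣? order
      ... | yes p∣order = record
        { χ = extend ; isCharacterOn = extend-isCharacterOn
        ; v = a ; v∈H = a∈extension ; χv≢0 = λ χa≡0 → 1#≢0# (≡.trans (≡.sym extend-a≡c) χa≡0) }
        where
        zero-isCharacterOn : IsCharacterOn subgroup (λ _ → 0#)
        zero-isCharacterOn = record { cong = λ _ _ → ≡.refl ; homo = λ _ _ → ≡.sym (+-identityˡ 0#) }
        open CharacterExtension subgroup a zero-isCharacterOn 1# (p∣n⇒n·x≡0# 1# p∣order)
      ... | no p∤order with euclidsLemma order (length (elements subgroup)) p-prime
                              (≡.subst (p ∣_) length-extension p∣|E|)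
      ...   | inj₁ p∣order = ⊥-elim (p∤order p∣order)
      ...   | inj₂ p∣|H|  = record
        { χ = extend ; isCharacterOn = extend-isCharacterOn
        ; v = v ; v∈H = H⊆extension v∈H ; χv≢0 = λ χv≡0 → χv≢0 (≡.trans (≡.sym (extend-extends v∈H)) χv≡0) }
        where
        open NonzeroCharacterOn (character p∣|H|)
        c = proj₁ (·-surjective p∤order (χ (a ^ order)))
        open CharacterExtension subgroup a isCharacterOn c (proj₂ (·-surjective p∤order (χ (a ^ order))))

    nonzero-character : p ∣ length enumeration → ∃[ ψ ] (IsCharacter ψ × ∃[ v ] ψ v ≢ 0#)
    nonzero-character p∣|A| = χ , isCharacter , v , χv≢0
      where
      open Stage (stage enumeration)
      everything : ∀ x → x ∈ elements subgroup
      everything x = contains (complete x)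
      |H|≡|A| : length (elements subgroup) ≡ length enumeration
      |H|≡|A| = ℕ.≤-antisym (unique⇒length≤ (FiniteSubgroup.unique subgroup) complete)
                            (unique⇒length≤ distinct everything)
      open NonzeroCharacterOn (character (≡.subst (p ∣_) (≡.sym |H|≡|A|) p∣|A|))
      open IsCharacterOn isCharacterOn
      isCharacter : IsCharacter χ
      isCharacter = record { cong = λ {x} → cong (everything x) ; homo = λ x y → homo (everything x) (everything y) }

module Eigencharacters {a ℓ} (A : AbelianGroup a ℓ) (p : ℕ) (p-prime : Prime p) where
  open AbelianGroup A
  open import Algebra.Properties.AbelianGroup A using (⁻¹-∙-comm; ⁻¹-anti-homo‿-; inverseʳ-unique; identityʳ-unique)
  open import Algebra.Properties.CommutativeSemigroup commutativeSemigroup using (interchange)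
  open import Relation.Binary.Reasoning.Setoid setoid
  open Residues p p-prime
  open Characters A p p-prime

  Eigen : (Carrier → Fin p) → (Carrier → Carrier) → Bool → Set a
  Eigen ψ τ e = ∀ x → ψ (τ x) ≡ sgn e (ψ x)

  module _ (p-odd : ¬ 2 ∣ p) {ι} {I : Set ι} (σ : I → Carrier → Carrier)
           (σ-cong : ∀ i {x y} → x ≈ y → σ i x ≈ σ i y)
           (σ-homo : ∀ i x y → σ i (x ∙ y) ≈ σ i x ∙ σ i y)
           (σ-involutive : ∀ i x → σ i (σ i x) ≈ x)
           (σ-comm : ∀ i j x → σ i (σ j x) ≈ σ j (σ i x)) (v : Carrier) where

    record EigenCharacter (is : List I) : Set (a ⊔ ℓ ⊔ ι) where
      field
        ψ           : Carrier → Fin p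
        isCharacter : IsCharacter ψ
        ψv≢0        : ψ v ≢ 0#
        eigen       : All (λ i → ∃[ e ] Eigen ψ (σ i) e) is

    σ-⁻¹ : ∀ i x → σ i (x ⁻¹) ≈ σ i x ⁻¹
    σ-⁻¹ i x = inverseʳ-unique (σ i x) (σ i (x ⁻¹))
      (trans (sym (σ-homo i x (x ⁻¹))) (trans (σ-cong i (inverseʳ x)) (σ-ε i)))
      where
      σ-ε : ∀ i → σ i ε ≈ ε
      σ-ε i = identityʳ-unique (σ i ε) (σ i ε) (trans (sym (σ-homo i ε ε)) (σ-cong i (identityʳ ε)))

    τ⁺ τ⁻ : I → Carrier → Carrier
    τ⁺ i x = x ∙ σ i x
    τ⁻ i x = x ∙ σ i x ⁻¹

    τ⁺-homo : ∀ i x y → τ⁺ i (x ∙ y) ≈ τ⁺ i x ∙ τ⁺ i y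
    τ⁺-homo i x y = trans (∙-congˡ (σ-homo i x y)) (interchange x y (σ i x) (σ i y))

    τ⁻-homo : ∀ i x y → τ⁻ i (x ∙ y) ≈ τ⁻ i x ∙ τ⁻ i y
    τ⁻-homo i x y = begin
      (x ∙ y) ∙ σ i (x ∙ y) ⁻¹           ≈⟨ ∙-congˡ (⁻¹-cong (σ-homo i x y)) ⟩
      (x ∙ y) ∙ (σ i x ∙ σ i y) ⁻¹       ≈⟨ ∙-congˡ (⁻¹-∙-comm (σ i x) (σ i y)) ⟨
      (x ∙ y) ∙ (σ i x ⁻¹ ∙ σ i y ⁻¹)    ≈⟨ interchange x y (σ i x ⁻¹) (σ i y ⁻¹) ⟩
      τ⁻ i x ∙ τ⁻ i y                    ∎

    σ-τ⁺ : ∀ i j x → σ j (τ⁺ i x) ≈ τ⁺ i (σ j x)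
    σ-τ⁺ i j x = trans (σ-homo j x (σ i x)) (∙-congˡ (σ-comm j i x))

    σ-τ⁻ : ∀ i j x → σ j (τ⁻ i x) ≈ τ⁻ i (σ j x)
    σ-τ⁻ i j x = trans (σ-homo j x (σ i x ⁻¹)) (∙-congˡ (trans (σ-⁻¹ j (σ i x)) (⁻¹-cong (σ-comm j i x))))

    τ⁺-eigen : ∀ {ψ} → IsCharacter ψ → ∀ i → Eigen (ψ ∘ τ⁺ i) (σ i) false
    τ⁺-eigen ψ-char i x = IsCharacter.cong ψ-char (trans (∙-congˡ (σ-involutive i x)) (comm (σ i x) x))

    τ⁻-eigen : ∀ {ψ} → IsCharacter ψ → ∀ i → Eigen (ψ ∘ τ⁻ i) (σ i) true
    τ⁻-eigen {ψ} ψ-char i x = ≡.trans (cong (begin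
      σ i x ∙ σ i (σ i x) ⁻¹   ≈⟨ ∙-congˡ (⁻¹-cong (σ-involutive i x)) ⟩
      σ i x ∙ x ⁻¹             ≈⟨ ⁻¹-anti-homo‿- x (σ i x) ⟨
      τ⁻ i x ⁻¹                ∎)) (⁻¹-homo (τ⁻ i x))
      where open IsCharacter ψ-char

    τ⁺∙τ⁻ : ∀ i x → τ⁺ i x ∙ τ⁻ i x ≈ x ∙ x
    τ⁺∙τ⁻ i x = begin
      (x ∙ σ i x) ∙ (x ∙ σ i x ⁻¹)   ≈⟨ interchange x (σ i x) x (σ i x ⁻¹) ⟩
      (x ∙ x) ∙ (σ i x ∙ σ i x ⁻¹)   ≈⟨ ∙-congˡ (inverseʳ (σ i x)) ⟩
      (x ∙ x) ∙ ε                    ≈⟨ identityʳ (x ∙ x) ⟩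
      x ∙ x                          ∎

    eigen-∘ : ∀ {ψ τ j} → IsCharacter ψ → (∀ x → σ j (τ x) ≈ τ (σ j x)) →
              ∃[ e ] Eigen ψ (σ j) e → ∃[ e ] Eigen (ψ ∘ τ) (σ j) e
    eigen-∘ {ψ} {τ} {j} ψ-char σ-τ (e , eigen) = e , λ x →
      ≡.trans (IsCharacter.cong ψ-char (sym (σ-τ x))) (eigen (τ x))

    -- ψ (τ⁺ i v) + ψ (τ⁻ i v) = ψ v + ψ v ≢ 0#, so one of ψ ∘ τ⁺ i and ψ ∘ τ⁻ i is
    -- nonzero at v; they are eigencharacters of σ i of sign + and − respectively.
    refine : ∀ {is} → EigenCharacter is → ∀ i → EigenCharacter (i ∷ is)
    refine E i with EigenCharacter.ψ E (τ⁺ i v) Fin.≟ 0#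
    ... | no ψ[τ⁺v]≢0 = record
      { ψ = ψ ∘ τ⁺ i
      ; isCharacter = ∘-isCharacter (λ x≈y → ∙-cong x≈y (σ-cong i x≈y)) (τ⁺-homo i)
      ; ψv≢0 = ψ[τ⁺v]≢0
      ; eigen = (false , τ⁺-eigen isCharacter i) ∷ All.map (λ {j} → eigen-∘ isCharacter (σ-τ⁺ i j)) eigen }
      where open EigenCharacter E
            open IsCharacter isCharacter
    ... | yes ψ[τ⁺v]≡0 = record
      { ψ = ψ ∘ τ⁻ i
      ; isCharacter = ∘-isCharacter (λ x≈y → ∙-cong x≈y (⁻¹-cong (σ-cong i x≈y))) (τ⁻-homo i)
      ; ψv≢0 = λ ψ[τ⁻v]≡0 → ψv≢0 (x+x≡0#⇒x≡0# p-odd (ψv+ψv≡0 ψ[τ⁻v]≡0))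
      ; eigen = (true , τ⁻-eigen isCharacter i) ∷ All.map (λ {j} → eigen-∘ isCharacter (σ-τ⁻ i j)) eigen }
      where
      open EigenCharacter E
      open IsCharacter isCharacter
      ψv+ψv≡0 : ψ (τ⁻ i v) ≡ 0# → ψ v + ψ v ≡ 0#
      ψv+ψv≡0 ψ[τ⁻v]≡0 = ≡.trans (≡.sym (homo v v)) (≡.trans (cong (sym (τ⁺∙τ⁻ i v)))
        (≡.trans (homo (τ⁺ i v) (τ⁻ i v)) (≡.trans (≡.cong₂ _+_ ψ[τ⁺v]≡0 ψ[τ⁻v]≡0) (+-identityˡ 0#))))

    eigencharacter : ∀ {ψ} → IsCharacter ψ → ψ v ≢ 0# → ∀ is → EigenCharacter is
    eigencharacter {ψ} ψ-char ψv≢0 []       = record { ψ = ψ ; isCharacter = ψ-char ; ψv≢0 = ψv≢0 ; eigen = [] }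
    eigencharacter     ψ-char ψv≢0 (i ∷ is) = refine (eigencharacter ψ-char ψv≢0 is) i

module Commutators {c ℓ} (G : Group c ℓ) where
  open Group G
  open Defs using (comm)
  open import Algebra.Properties.Group G using (⁻¹-anti-homo-∙; ⁻¹-involutive; ε⁻¹≈ε; inverseʳ-unique)
  open import Algebra.Properties.Monoid monoid using (cancelˡ; cancelʳ; cancelᶜ)
  open import Relation.Binary.Reasoning.Setoid setoid

  Γ′ : Carrier → Set (c ⊔ ℓ)
  Γ′ = InDerived G

  Γ′-resp-≈ : ∀ {x y} → x ≈ y → Γ′ x → Γ′ y
  Γ′-resp-≈ x≈y (l , x≈) = l , trans (sym x≈y) x≈

  ε∈Γ′ : Γ′ ε
  ε∈Γ′ = [] , refl

  comm∈Γ′ : ∀ a b → Γ′ (comm G a b)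
  comm∈Γ′ a b = (a , b) ∷ [] , sym (identityʳ (comm G a b))

  prodComm-++ : ∀ l₁ l₂ → prodComm G (l₁ ++ l₂) ≈ prodComm G l₁ ∙ prodComm G l₂
  prodComm-++ []              l₂ = sym (identityˡ (prodComm G l₂))
  prodComm-++ ((a , b) ∷ l₁) l₂ = trans (∙-congˡ (prodComm-++ l₁ l₂)) (sym (assoc _ _ _))

  ∙∈Γ′ : ∀ {x y} → Γ′ x → Γ′ y → Γ′ (x ∙ y)
  ∙∈Γ′ (l₁ , x≈) (l₂ , y≈) = l₁ ++ l₂ , trans (∙-cong x≈ y≈) (sym (prodComm-++ l₁ l₂))

  comm-cong : ∀ {a a′ b b′} → a ≈ a′ → b ≈ b′ → comm G a b ≈ comm G a′ b′
  comm-cong a≈a′ b≈b′ = ∙-cong (∙-cong (∙-cong (⁻¹-cong a≈a′) (⁻¹-cong b≈b′)) a≈a′) b≈b′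

  comm-⁻¹ : ∀ a b → comm G a b ⁻¹ ≈ comm G b a
  comm-⁻¹ a b = sym (inverseʳ-unique (comm G a b) (comm G b a) (begin
    ((a ⁻¹ ∙ b ⁻¹) ∙ a) ∙ b ∙ (((b ⁻¹ ∙ a ⁻¹) ∙ b) ∙ a)     ≈⟨ solve monoid ⟩
    (a ⁻¹ ∙ b ⁻¹) ∙ (a ∙ (b ∙ (b ⁻¹ ∙ (a ⁻¹ ∙ (b ∙ a))))) ≈⟨ ∙-congˡ (∙-congˡ (cancelˡ (inverseʳ b) (a ⁻¹ ∙ (b ∙ a)))) ⟩
    (a ⁻¹ ∙ b ⁻¹) ∙ (a ∙ (a ⁻¹ ∙ (b ∙ a)))               ≈⟨ ∙-congˡ (cancelˡ (inverseʳ a) (b ∙ a)) ⟩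
    (a ⁻¹ ∙ b ⁻¹) ∙ (b ∙ a)                             ≈⟨ cancelᶜ (inverseˡ b) (a ⁻¹) a ⟩
    a ⁻¹ ∙ a                                            ≈⟨ inverseˡ a ⟩
    ε                                                   ∎))

  ⁻¹∈Γ′ : ∀ {x} → Γ′ x → Γ′ (x ⁻¹)
  ⁻¹∈Γ′ (l , x≈) = Γ′-resp-≈ (sym (⁻¹-cong x≈)) (prodComm⁻¹∈Γ′ l)
    where
    prodComm⁻¹∈Γ′ : ∀ l → Γ′ (prodComm G l ⁻¹)
    prodComm⁻¹∈Γ′ []            = Γ′-resp-≈ (sym ε⁻¹≈ε) ε∈Γ′
    prodComm⁻¹∈Γ′ ((a , b) ∷ l) = Γ′-resp-≈ (sym (⁻¹-anti-homo-∙ (comm G a b) (prodComm G l)))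
      (∙∈Γ′ (prodComm⁻¹∈Γ′ l) (Γ′-resp-≈ (sym (comm-⁻¹ a b)) (comm∈Γ′ b a)))

  κ : Carrier → Carrier → Carrier
  κ g x = g ∙ x ∙ g ⁻¹

  κ-cong : ∀ {g h x y} → g ≈ h → x ≈ y → κ g x ≈ κ h y
  κ-cong g≈h x≈y = ∙-cong (∙-cong g≈h x≈y) (⁻¹-cong g≈h)

  κ-homo : ∀ g x y → κ g (x ∙ y) ≈ κ g x ∙ κ g y
  κ-homo g x y = begin
    g ∙ (x ∙ y) ∙ g ⁻¹                      ≈⟨ solve monoid ⟩
    (g ∙ x) ∙ (y ∙ g ⁻¹)                    ≈⟨ cancelᶜ (inverseˡ g) (g ∙ x) (y ∙ g ⁻¹) ⟨
    (g ∙ x ∙ g ⁻¹) ∙ (g ∙ (y ∙ g ⁻¹))       ≈⟨ solve monoid ⟩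
    (g ∙ x ∙ g ⁻¹) ∙ (g ∙ y ∙ g ⁻¹)         ∎

  κ-∙ : ∀ g h x → κ (g ∙ h) x ≈ κ g (κ h x)
  κ-∙ g h x = begin
    g ∙ h ∙ x ∙ (g ∙ h) ⁻¹                  ≈⟨ ∙-congˡ (⁻¹-anti-homo-∙ g h) ⟩
    g ∙ h ∙ x ∙ (h ⁻¹ ∙ g ⁻¹)               ≈⟨ solve monoid ⟩
    g ∙ (h ∙ x ∙ h ⁻¹) ∙ g ⁻¹               ∎

  κ∈Γ′ : ∀ g {x} → Γ′ x → Γ′ (κ g x)
  κ∈Γ′ g {x} x∈Γ′ = Γ′-resp-≈ (sym κgx≈x∙[x,g⁻¹]) (∙∈Γ′ x∈Γ′ (comm∈Γ′ x (g ⁻¹)))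
    where
    κgx≈x∙[x,g⁻¹] : κ g x ≈ x ∙ comm G x (g ⁻¹)
    κgx≈x∙[x,g⁻¹] = begin
      g ∙ x ∙ g ⁻¹                              ≈⟨ cancelˡ (inverseʳ x) (g ∙ x ∙ g ⁻¹) ⟨
      x ∙ (x ⁻¹ ∙ (g ∙ x ∙ g ⁻¹))               ≈⟨ solve monoid ⟩
      x ∙ ((x ⁻¹ ∙ g) ∙ x ∙ g ⁻¹)               ≈⟨ ∙-congˡ (∙-congʳ (∙-congʳ (∙-congˡ (⁻¹-involutive g)))) ⟨
      x ∙ ((x ⁻¹ ∙ g ⁻¹ ⁻¹) ∙ x ∙ g ⁻¹)         ∎

  -- x s x⁻¹ s⁻¹: with this convention x ↦ ⁅ x , s ⁆ is a crossed homomorphism for κ.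
  ⁅_,_⁆ : Carrier → Carrier → Carrier
  ⁅ x , s ⁆ = comm G (x ⁻¹) (s ⁻¹)

  ⁅⁆≈κ∙⁻¹ : ∀ x s → ⁅ x , s ⁆ ≈ κ x s ∙ s ⁻¹
  ⁅⁆≈κ∙⁻¹ x s = ∙-congʳ (∙-congʳ (∙-cong (⁻¹-involutive x) (⁻¹-involutive s)))

  ⁅⁆-cocycle : ∀ x y s → ⁅ x ∙ y , s ⁆ ≈ κ x ⁅ y , s ⁆ ∙ ⁅ x , s ⁆
  ⁅⁆-cocycle x y s = begin
    ⁅ x ∙ y , s ⁆                                     ≈⟨ ⁅⁆≈κ∙⁻¹ (x ∙ y) s ⟩
    κ (x ∙ y) s ∙ s ⁻¹                                ≈⟨ ∙-congʳ (κ-∙ x y s) ⟩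
    κ x (κ y s) ∙ s ⁻¹                                ≈⟨ cancelᶜ κxs⁻¹∙κxs≈ε (κ x (κ y s)) (s ⁻¹) ⟨
    (κ x (κ y s) ∙ κ x (s ⁻¹)) ∙ (κ x s ∙ s ⁻¹)       ≈⟨ ∙-congʳ (κ-homo x (κ y s) (s ⁻¹)) ⟨
    κ x (κ y s ∙ s ⁻¹) ∙ (κ x s ∙ s ⁻¹)               ≈⟨ ∙-cong (κ-cong refl (⁅⁆≈κ∙⁻¹ y s)) (⁅⁆≈κ∙⁻¹ x s) ⟨
    κ x ⁅ y , s ⁆ ∙ ⁅ x , s ⁆                         ∎
    where
    κxs⁻¹∙κxs≈ε : κ x (s ⁻¹) ∙ κ x s ≈ ε
    κxs⁻¹∙κxs≈ε = begin
      κ x (s ⁻¹) ∙ κ x s     ≈⟨ κ-homo x (s ⁻¹) s ⟨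
      κ x (s ⁻¹ ∙ s)         ≈⟨ κ-cong refl (inverseˡ s) ⟩
      x ∙ ε ∙ x ⁻¹           ≈⟨ ∙-congʳ (identityʳ x) ⟩
      x ∙ x ⁻¹               ≈⟨ inverseʳ x ⟩
      ε                      ∎

  ⁅⁆≈∙κ⁻¹ : ∀ a s → ⁅ a , s ⁆ ≈ a ∙ κ s (a ⁻¹)
  ⁅⁆≈∙κ⁻¹ a s = begin
    ⁅ a , s ⁆                ≈⟨ ⁅⁆≈κ∙⁻¹ a s ⟩
    a ∙ s ∙ a ⁻¹ ∙ s ⁻¹      ≈⟨ solve monoid ⟩
    a ∙ (s ∙ a ⁻¹ ∙ s ⁻¹)    ∎

  ⁅s,s⁆≈ε : ∀ s → ⁅ s , s ⁆ ≈ ε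
  ⁅s,s⁆≈ε s = begin
    ⁅ s , s ⁆          ≈⟨ ⁅⁆≈κ∙⁻¹ s s ⟩
    s ∙ s ∙ s ⁻¹ ∙ s ⁻¹ ≈⟨ ∙-congʳ (cancelʳ (inverseʳ s) s) ⟩
    s ∙ s ⁻¹           ≈⟨ inverseʳ s ⟩
    ε                  ∎

  comm≈⁅⁆ : ∀ a b → comm G a b ≈ ⁅ a ⁻¹ , b ⁻¹ ⁆
  comm≈⁅⁆ a b = comm-cong (sym (⁻¹-involutive a)) (sym (⁻¹-involutive b))

  ∙∙comm : ∀ g h → h ∙ g ∙ comm G g h ≈ g ∙ h
  ∙∙comm g h = begin
    h ∙ g ∙ (g ⁻¹ ∙ h ⁻¹ ∙ g ∙ h)        ≈⟨ solve monoid ⟩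
    h ∙ (g ∙ (g ⁻¹ ∙ (h ⁻¹ ∙ (g ∙ h))))  ≈⟨ ∙-congˡ (cancelˡ (inverseʳ g) (h ⁻¹ ∙ (g ∙ h))) ⟩
    h ∙ (h ⁻¹ ∙ (g ∙ h))                 ≈⟨ cancelˡ (inverseʳ h) (g ∙ h) ⟩
    g ∙ h                                ∎

  module AbelianDerivedSubgroup (Γ′-abelian : DerivedAbelian G) (elementary : AbelianizationElementary2 G) where

    κ-trivial : ∀ {a x} → Γ′ a → Γ′ x → κ a x ≈ x
    κ-trivial {a} {x} a∈Γ′ x∈Γ′ = trans (∙-congʳ (Γ′-abelian a x a∈Γ′ x∈Γ′)) (cancelʳ (inverseʳ a) x)

    κ-involutive : ∀ g {x} → Γ′ x → κ g (κ g x) ≈ x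
    κ-involutive g {x} x∈Γ′ = trans (sym (κ-∙ g g x)) (κ-trivial (elementary g) x∈Γ′)

    κ-comm : ∀ g h {x} → Γ′ x → κ g (κ h x) ≈ κ h (κ g x)
    κ-comm g h {x} x∈Γ′ = begin
      κ g (κ h x)                      ≈⟨ κ-∙ g h x ⟨
      κ (g ∙ h) x                      ≈⟨ κ-cong (∙∙comm g h) refl ⟨
      κ (h ∙ g ∙ comm G g h) x         ≈⟨ κ-∙ (h ∙ g) (comm G g h) x ⟩
      κ (h ∙ g) (κ (comm G g h) x)     ≈⟨ κ-cong refl (κ-trivial (comm∈Γ′ g h) x∈Γ′) ⟩
      κ (h ∙ g) x                      ≈⟨ κ-∙ h g x ⟩
      κ h (κ g x)                      ∎

    Γ′-abelianGroup : AbelianGroup (c ⊔ ℓ) ℓ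
    Γ′-abelianGroup = record
      { Carrier = Σ Carrier Γ′
      ; _≈_ = λ x y → proj₁ x ≈ proj₁ y
      ; _∙_ = λ (x , x∈Γ′) (y , y∈Γ′) → x ∙ y , ∙∈Γ′ x∈Γ′ y∈Γ′
      ; ε = ε , ε∈Γ′
      ; _⁻¹ = λ (x , x∈Γ′) → x ⁻¹ , ⁻¹∈Γ′ x∈Γ′
      ; isAbelianGroup = record
        { isGroup = record
          { isMonoid = record
            { isSemigroup = record
              { isMagma = record
                { isEquivalence = record { refl = refl ; sym = sym ; trans = trans }
                ; ∙-cong = ∙-cong }
              ; assoc = λ x y z → assoc (proj₁ x) (proj₁ y) (proj₁ z) }
            ; identity = (λ x → identityˡ (proj₁ x)) , (λ x → identityʳ (proj₁ x)) }
          ; inverse = (λ x → inverseˡ (proj₁ x)) , (λ x → inverseʳ (proj₁ x))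
          ; ⁻¹-cong = ⁻¹-cong }
        ; comm = λ (x , x∈Γ′) (y , y∈Γ′) → Γ′-abelian x y x∈Γ′ y∈Γ′ } }

    open AbelianGroup Γ′-abelianGroup using () renaming (_∙_ to _∙′_)

    κ′ : Carrier → Σ Carrier Γ′ → Σ Carrier Γ′
    κ′ g (x , x∈Γ′) = κ g x , κ∈Γ′ g x∈Γ′

    open import Data.List.Membership.Setoid (AbelianGroup.setoid Γ′-abelianGroup) using (_∈_)
    open import Data.List.Relation.Unary.Unique.Setoid using (Unique)

    Γ′-enumeration : ∀ {k} → DerivedHasOrder G k →
                     ∃[ l ] ((∀ x → x ∈ l) × Unique (AbelianGroup.setoid Γ′-abelianGroup) l × length l ≡ k)
    Γ′-enumeration (l , distinct , l⊆Γ′ , complete , |l|≡k) =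
      All.toList l⊆Γ′ ,
      (λ (x , x∈Γ′) → Any.map⁻ (≡.subst (Any (x ≈_)) (≡.sym (map-proj₁-toList l⊆Γ′)) (complete x x∈Γ′))) ,
      Unique.map⁻ (AbelianGroup.setoid Γ′-abelianGroup) setoid id
        (≡.subst (Unique setoid) (≡.sym (map-proj₁-toList l⊆Γ′)) distinct) ,
      ≡.trans (≡.sym (length-map proj₁ (All.toList l⊆Γ′))) (≡.trans (≡.cong length (map-proj₁-toList l⊆Γ′)) |l|≡k)

    κ′-cong : ∀ g {x y} → proj₁ x ≈ proj₁ y → proj₁ (κ′ g x) ≈ proj₁ (κ′ g y)
    κ′-cong g = κ-cong refl

    κ′-homo : ∀ g x y → proj₁ (κ′ g (x ∙′ y)) ≈ proj₁ (κ′ g x ∙′ κ′ g y)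
    κ′-homo g (x , _) (y , _) = κ-homo g x y

    κ′-involutive : ∀ g x → proj₁ (κ′ g (κ′ g x)) ≈ proj₁ x
    κ′-involutive g (_ , x∈Γ′) = κ-involutive g x∈Γ′

    κ′-comm : ∀ g h x → proj₁ (κ′ g (κ′ h x)) ≈ proj₁ (κ′ h (κ′ g x))
    κ′-comm g h (_ , x∈Γ′) = κ-comm g h x∈Γ′

module DihedralQuotient {c ℓ} (G : Group c ℓ) (Γ′-abelian : DerivedAbelian G)
  (elementary : AbelianizationElementary2 G) (p : ℕ) (p-prime : Prime p) (p-odd : ¬ 2 ∣ p) where
  open Group G
  open Defs using (comm)
  open Commutators G
  open AbelianDerivedSubgroup Γ′-abelian elementary
  open Residues p p-prime
  open Characters Γ′-abelianGroup p p-prime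
  open Eigencharacters Γ′-abelianGroup p p-prime using (Eigen)
  open AbelianGroup Γ′-abelianGroup using () renaming (_∙_ to _∙′_; _⁻¹ to _⁻¹′)

  Eigen-resp : ∀ {ψ g h e} → IsCharacter ψ → g ≈ h → Eigen ψ (κ′ h) e → Eigen ψ (κ′ g) e
  Eigen-resp ψ-isCharacter g≈h eigen x = ≡.trans (IsCharacter.cong ψ-isCharacter (κ-cong g≈h refl)) (eigen x)

  eigen-everywhere : ∀ {ψ L} → IsCharacter ψ → (∀ g → Any (g ≈_) L) →
                     All (λ g → ∃[ e ] Eigen ψ (κ′ g) e) L → ∀ g → ∃[ e ] Eigen ψ (κ′ g) e
  eigen-everywhere ψ-isCharacter complete eigen g =
    All.lookupWith (λ (e , eigen-h) g≈h → e , Eigen-resp {e = e} ψ-isCharacter g≈h eigen-h) eigen (complete g)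

  module _ {ψ} (ψ-isCharacter : IsCharacter ψ) {v} (ψv≢0 : ψ v ≢ 0#)
           (eigen : ∀ g → ∃[ e ] Eigen ψ (κ′ g) e) where
    open IsCharacter ψ-isCharacter

    sign : Carrier → Bool
    sign g = proj₁ (eigen g)

    sign-unique : ∀ {g e} → Eigen ψ (κ′ g) e → sign g ≡ e
    sign-unique {g} {e} eigen-e = sgn-injective p-odd ψv≢0 (sign g) e
      (≡.trans (≡.sym (proj₂ (eigen g) v)) (eigen-e v))

    sign-spec : ∀ g a → ψ (κ′ g a) ≡ sgn (sign g) (ψ a)
    sign-spec g = proj₂ (eigen g)

    sign-cong : ∀ {g h} → g ≈ h → sign g ≡ sign h
    sign-cong {g} {h} g≈h = ≡.sym (sign-unique λ a → ≡.trans (cong (κ-cong (sym g≈h) refl)) (sign-spec g a))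

    sign-homo : ∀ g h → sign (g ∙ h) ≡ sign g xor sign h
    sign-homo g h = sign-unique λ a → begin
      ψ (κ′ (g ∙ h) a)                    ≡⟨ cong (κ-∙ g h (proj₁ a)) ⟩
      ψ (κ′ g (κ′ h a))                   ≡⟨ sign-spec g (κ′ h a) ⟩
      sgn (sign g) (ψ (κ′ h a))           ≡⟨ ≡.cong (sgn (sign g)) (sign-spec h a) ⟩
      sgn (sign g) (sgn (sign h) (ψ a))   ≡⟨ sgn-xor (sign g) (sign h) (ψ a) ⟩
      sgn (sign g xor sign h) (ψ a)       ∎
      where open ≡.≡-Reasoning

    sign-Γ′ : ∀ {a} → Γ′ a → sign a ≡ false
    sign-Γ′ a∈Γ′ = sign-unique λ (x , x∈Γ′) → cong (κ-trivial a∈Γ′ x∈Γ′)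

    ⁅_,_⁆′ : Carrier → Carrier → Σ Carrier Γ′
    ⁅ x , s ⁆′ = ⁅ x , s ⁆ , comm∈Γ′ (x ⁻¹) (s ⁻¹)

    ψ⁅⁆-crossed : ∀ x y s → ψ ⁅ x ∙ y , s ⁆′ ≡ ψ ⁅ x , s ⁆′ + sgn (sign x) (ψ ⁅ y , s ⁆′)
    ψ⁅⁆-crossed x y s = begin
      ψ ⁅ x ∙ y , s ⁆′                                   ≡⟨ cong (⁅⁆-cocycle x y s) ⟩
      ψ (κ′ x ⁅ y , s ⁆′ ∙′ ⁅ x , s ⁆′)                  ≡⟨ homo (κ′ x ⁅ y , s ⁆′) ⁅ x , s ⁆′ ⟩
      ψ (κ′ x ⁅ y , s ⁆′) + ψ ⁅ x , s ⁆′                 ≡⟨ ≡.cong (_+ ψ ⁅ x , s ⁆′) (sign-spec x ⁅ y , s ⁆′) ⟩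
      sgn (sign x) (ψ ⁅ y , s ⁆′) + ψ ⁅ x , s ⁆′         ≡⟨ +-comm (sgn (sign x) (ψ ⁅ y , s ⁆′)) (ψ ⁅ x , s ⁆′) ⟩
      ψ ⁅ x , s ⁆′ + sgn (sign x) (ψ ⁅ y , s ⁆′)         ∎
      where open ≡.≡-Reasoning

    ψ⁅⁆-Γ′ : ∀ a s → ψ ⁅ proj₁ a , s ⁆′ ≡ ψ a + sgn (sign s) (- ψ a)
    ψ⁅⁆-Γ′ a s = begin
      ψ ⁅ proj₁ a , s ⁆′                 ≡⟨ cong (⁅⁆≈∙κ⁻¹ (proj₁ a) s) ⟩
      ψ (a ∙′ κ′ s (a ⁻¹′))              ≡⟨ homo a (κ′ s (a ⁻¹′)) ⟩
      ψ a + ψ (κ′ s (a ⁻¹′))             ≡⟨ ≡.cong (ψ a +_) (sign-spec s (a ⁻¹′)) ⟩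
      ψ a + sgn (sign s) (ψ (a ⁻¹′))     ≡⟨ ≡.cong (λ y → ψ a + sgn (sign s) y) (⁻¹-homo a) ⟩
      ψ a + sgn (sign s) (- ψ a)         ∎
      where open ≡.≡-Reasoning

    -- With all signs +, x ↦ ψ ⁅ x , s ⁆′ is a homomorphism Γ → ℤₚ vanishing on the
    -- squares (which lie in Γ′), hence zero as p is odd.
    module _ (sign-trivial : ∀ g → sign g ≡ false) where

      ψ⁅⁆≡0# : ∀ x s → ψ ⁅ x , s ⁆′ ≡ 0#
      ψ⁅⁆≡0# x s = x+x≡0#⇒x≡0# p-odd (begin
        ψ ⁅ x , s ⁆′ + ψ ⁅ x , s ⁆′                 ≡⟨ ≡.cong (λ e → ψ ⁅ x , s ⁆′ + sgn e (ψ ⁅ x , s ⁆′)) (sign-trivial x) ⟨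
        ψ ⁅ x , s ⁆′ + sgn (sign x) (ψ ⁅ x , s ⁆′)  ≡⟨ ψ⁅⁆-crossed x x s ⟨
        ψ ⁅ x ∙ x , s ⁆′                            ≡⟨ ψ⁅⁆-Γ′ x² s ⟩
        ψ x² + sgn (sign s) (- ψ x²)                ≡⟨ ≡.cong (λ e → ψ x² + sgn e (- ψ x²)) (sign-trivial s) ⟩
        ψ x² + - ψ x²                               ≡⟨ +-inverseʳ (ψ x²) ⟩
        0#                                          ∎)
        where
        open ≡.≡-Reasoning
        x² = x ∙ x , elementary x

      ψ-prodComm≡0# : ∀ l → ψ (prodComm G l , l , refl) ≡ 0#
      ψ-prodComm≡0# []            = ε-homo
      ψ-prodComm≡0# ((a , b) ∷ l) = begin
        ψ (comm G a b ∙ prodComm G l , _)                     ≡⟨ cong (∙-congʳ (comm≈⁅⁆ a b)) ⟩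
        ψ (⁅ a ⁻¹ , b ⁻¹ ⁆′ ∙′ (prodComm G l , l , refl))     ≡⟨ homo ⁅ a ⁻¹ , b ⁻¹ ⁆′ (prodComm G l , l , refl) ⟩
        ψ ⁅ a ⁻¹ , b ⁻¹ ⁆′ + ψ (prodComm G l , l , refl)      ≡⟨ ≡.cong₂ _+_ (ψ⁅⁆≡0# (a ⁻¹) (b ⁻¹)) (ψ-prodComm≡0# l) ⟩
        0# + 0#                                               ≡⟨ +-identityˡ 0# ⟩
        0#                                                    ∎
        where open ≡.≡-Reasoning

    sign-nontrivial : ¬ (∀ g → sign g ≡ false)
    sign-nontrivial sign-trivial =
      ψv≢0 (≡.trans (cong (proj₂ (proj₂ v))) (ψ-prodComm≡0# sign-trivial (proj₁ (proj₂ v))))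

    ∃sign≡true : IsFinite G → ∃[ t ] sign t ≡ true
    ∃sign≡true (L , complete) with Any.any? (λ g → sign g Bool.≟ true) L
    ... | yes found = Any.satisfied found
    ... | no  none  = ⊥-elim (sign-nontrivial λ g → ¬-not λ sign-g≡true →
                        none (Any.map (λ g≈h → ≡.trans (≡.sym (sign-cong g≈h)) sign-g≡true) (complete g)))

    ·D-sgn : ∀ e a f b → (e , a) ·D (f , b) ≡ (e xor f , a + sgn e b)
    ·D-sgn false a f b = ≡.refl
    ·D-sgn true  a f b = ≡.refl

    module _ {t} (sign-t : sign t ≡ true) where

      φ : Carrier → Bool × Fin p
      φ g = sign g , ψ ⁅ g , t ⁆′

      φ-cong : ∀ x y → x ≈ y → φ x ≡ φ y
      φ-cong x y x≈y = ≡.cong₂ _,_ (sign-cong x≈y) (cong (comm-cong (⁻¹-cong x≈y) refl))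

      φ-homo : ∀ x y → φ (x ∙ y) ≡ φ x ·D φ y
      φ-homo x y = ≡.trans (≡.cong₂ _,_ (sign-homo x y) (ψ⁅⁆-crossed x y t))
                           (≡.sym (·D-sgn (sign x) (ψ ⁅ x , t ⁆′) (sign y) (ψ ⁅ y , t ⁆′)))

      φ-Γ′ : ∀ a → φ (proj₁ a) ≡ (false , ψ a + ψ a)
      φ-Γ′ a = ≡.cong₂ _,_ (sign-Γ′ (proj₂ a)) (begin
        ψ ⁅ proj₁ a , t ⁆′             ≡⟨ ψ⁅⁆-Γ′ a t ⟩
        ψ a + sgn (sign t) (- ψ a)     ≡⟨ ≡.cong (λ e → ψ a + sgn e (- ψ a)) sign-t ⟩
        ψ a + - - ψ a                  ≡⟨ ≡.cong (ψ a +_) (-‿involutive (ψ a)) ⟩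
        ψ a + ψ a                      ∎)
        where open ≡.≡-Reasoning

      φ-t : φ t ≡ (true , 0#)
      φ-t = ≡.cong₂ _,_ sign-t (≡.trans (cong (⁅s,s⁆≈ε t)) ε-homo)

      φ-surjective : ∀ d → ∃[ g ] φ g ≡ d
      φ-surjective (false , w) =
        let u , u+u≡w = halve p-odd w
            a , ψa≡u = surjective ψv≢0 u
        in proj₁ a , ≡.trans (φ-Γ′ a) (≡.cong (false ,_) (≡.trans (≡.cong₂ _+_ ψa≡u ψa≡u) u+u≡w))
      φ-surjective (true , w) =
        let a , φa≡[false,w] = φ-surjective (false , w)
        in a ∙ t , (begin
          φ (a ∙ t)                   ≡⟨ φ-homo a t ⟩
          φ a ·D φ t                  ≡⟨ ≡.cong₂ _·D_ φa≡[false,w] φ-t ⟩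
          (false , w) ·D (true , 0#)  ≡⟨ ≡.cong (true ,_) (+-identityʳ w) ⟩
          (true , w)                  ∎)
        where open ≡.≡-Reasoning

    dihedralQuotient : IsFinite G → HasDihedralQuotient G
    dihedralQuotient finite with t , sign-t ← ∃sign≡true finite =
      φ sign-t , φ-cong sign-t , φ-homo sign-t , φ-surjective sign-t

proposition3p1 : ∀ {c ℓ} (G : Group c ℓ) → IsFinite G
                   → DerivedAbelian G
                   → (p : ℕ) (pp : Prime p) → ¬ (2 ∣ p)
                   → (∃[ k ] (DerivedHasOrder G k × p ∣ k))
                   → AbelianizationElementary2 G
                   → HasDihedralQuotient {p} {{prime⇒nonZero pp}} G
proposition3p1 G finite@(L , L-complete) Γ′-abelian p p-prime p-odd (k , |Γ′|≡k , p∣k) elementary =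
  let l , l-complete , l-distinct , |l|≡k = Γ′-enumeration |Γ′|≡k
      ψ₀ , ψ₀-isCharacter , v , ψ₀v≢0 = nonzero-character l l-complete l-distinct (≡.subst (p ∣_) (≡.sym |l|≡k) p∣k)
      E = eigencharacter p-odd κ′ κ′-cong κ′-homo κ′-involutive κ′-comm v ψ₀-isCharacter ψ₀v≢0 L
      open EigenCharacter E
  in dihedralQuotient isCharacter ψv≢0 (eigen-everywhere isCharacter L-complete eigen) finite
  where
  open Commutators G
  open AbelianDerivedSubgroup Γ′-abelian elementary
  open FiniteAbelianGroup Γ′-abelianGroup p p-prime
  open Eigencharacters Γ′-abelianGroup p p-prime
  open DihedralQuotient G Γ′-abelian elementary p p-prime p-odd
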